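{- Let $k\geq4$, $0<\eta,\mu\leq 1/k^3$, let $0<\nu=\nu(n)\leq 1/k^3$ and $0\leq m=m(n)\leq n^2$ with $\nu^2>4m/n^2$ for all $n$. There exists $n_0$ such that for all $n\geq n_0$ the following holds. Let $Q=(Q_0,\{Q_1,\dots,Q_{k-2}\})$ be an ordered $(k-1)$-partition of $[n]$ and $S\subseteq[n]$ with $|S|\leq n/k^2$. Then for every $G\in F_Q(n,k,\eta,\mu)$ that satisfies $(\mathrm{F}1)_\nu$ with respect to $Q$ and has at most $m$ internal non-edges, every optimal ordered $(k-1)$-partition of $G-S$ is an element of $\mathcal{P}(Q-S,k^4\nu^2n)$.
   Context: An ordered $(k-1)$-partition of a set $V$ is a partition of $V$ into $k-1$ (possibly empty) classes, one labelled $Q_0$ and the others unlabelled. For a graph $G$ on $V$, $h(Q,G)$ is the number of non-adjacent pairs inside a single class; $Q$ is an optimal ordered $(k-1)$-partition of $G$ if it minimises $h(\cdot,G)$ over all ordered $(k-1)$-partitions of $V$. An internal non-edge is a non-adjacent pair inside one class of $Q$. $F_Q(n,k,\eta)$: graphs on $[n]$ with no induced $C_{2k}$, for which $Q$ is optimal and $h(Q,G)\leq\eta n^2$. Property $(\mathrm{F}1)_\nu$: for all distinct $i,j$ and $U_i\subseteq Q_i$, $U_j\subseteq Q_j$ with $|U_i||U_j|\geq\nu^2n^2$, $\frac14\leq e(U_i,U_j)/(|U_i||U_j|)\leq\frac34$. Property $(\mathrm{F}2)_\mu$: $\big||Q_i|-\frac n{k-1}\big|\leq \mu n$ for all $i$.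 $F_Q(n,k,\eta,\mu)$ is the set of $G\in F_Q(n,k,\eta)$ satisfying $(\mathrm{F}1)_\mu$ and $(\mathrm{F}2)_\mu$ with respect to $Q$. $Q-S$ is the ordered $(k-1)$-partition of $[n]\setminus S$ obtained by deleting the elements of $S$ from their classes. For an ordered $(k-1)$-partition $P$ and $t\geq0$, $\mathcal{P}(P,t)$ is the set of ordered $(k-1)$-partitions of the same set obtainable from $P$ by moving at most $t$ elements between classes and possibly choosing a different class to be the labelled one.
   Formalization: The parameters η, μ and the values ν(n), m(n) are taken in the rationals. -}

module Defs where

open import Data.Bool using (Bool; true; false; _∧_; _∨_; not; if_then_else_)
open import Data.Nat as ℕ using (ℕ; zero; suc; _+_; _∸_; _≡ᵇ_; _<ᵇ_)
open import Data.Fin using (Fin; toℕ) renaming (zero to fzero; suc to fsuc)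
import Data.Fin.Properties as FinP
open import Data.Integer using (+_)
open import Data.Rational using (ℚ; _/_; _*_; _-_; ∣_∣; _≤_; _<_)
open import Data.Product using (Σ; ∃; _×_; _,_)
open import Function.Bundles using (_↔_; Inverse)
open import Relation.Nullary.Decidable using (⌊_⌋)
open import Relation.Binary.PropositionalEquality using (_≡_; _≢_)

toℚ : ℕ → ℚ
toℚ n = + n / 1

count : ∀ {n} → (Fin n → Bool) → ℕ
count {zero}  p = 0
count {suc n} p = (if p fzero then 1 else 0) + count (λ i → p (fsuc i))

sumFin : ∀ {n} → (Fin n → ℕ) → ℕ
sumFin {zero}  f = 0
sumFin {suc n} f = f fzero + sumFin (λ i → f (fsuc i))

countPairs : ∀ {n} → (Fin n → Fin n → Bool) → ℕ
countPairs p = sumFin (λ i → count (p i))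

_==_ : ∀ {r} → Fin r → Fin r → Bool
i == j = ⌊ i FinP.≟ j ⌋

record Graph (n : ℕ) : Set where
  field
    adj    : Fin n → Fin n → Bool
    sym    : ∀ i j → adj i j ≡ adj j i
    irrefl : ∀ i → adj i i ≡ false
open Graph public

cycAdj : (L : ℕ) → Fin L → Fin L → Bool
cycAdj L i j =
  (suc (toℕ i) ≡ᵇ toℕ j) ∨ (suc (toℕ j) ≡ᵇ toℕ i)
  ∨ ((toℕ i ≡ᵇ 0) ∧ (toℕ j ≡ᵇ (L ∸ 1)))
  ∨ ((toℕ j ≡ᵇ 0) ∧ (toℕ i ≡ᵇ (L ∸ 1)))

HasInducedCycle : ∀ {n} → ℕ → Graph n → Set
HasInducedCycle {n} L G =
  Σ (Fin L → Fin n) λ f →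
    (∀ i j → f i ≡ f j → i ≡ j) ×
    (∀ i j → i ≢ j → adj G (f i) (f j) ≡ cycAdj L i j)

-- An ordered r-partition (r = k-1) of a vertex set W ⊆ [n] is given by a
-- class function Fin n → Fin r (values outside W are irrelevant);
-- class fzero is the labelled class Q_0, the others are unlabelled.
Part : ℕ → ℕ → Set
Part n r = Fin n → Fin r

VSet : ℕ → Set
VSet n = Fin n → Bool

full : ∀ {n} → VSet n
full _ = true

minus : ∀ {n} → VSet n → VSet n
minus S i = not (S i)

h : ∀ {n r} → VSet n → Graph n → Part n r → ℕ
h W G P = countPairs λ i j →
  (toℕ i <ᵇ toℕ j) ∧ W i ∧ W j ∧ (P i == P j) ∧ not (adj G i j)

Optimal : ∀ {n r} → VSet n → Graph n → Part n r → Set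
Optimal {n} {r} W G P = ∀ (P' : Part n r) → h W G P ℕ.≤ h W G P'

-- P' ∈ 𝒫(P, t) (partitions of W): after renaming the classes by a
-- bijection σ (which may change the labelled class, and permutes the
-- unlabelled ones), P' differs from P on at most t elements of W.
InNbhd : ∀ {n r} → VSet n → Part n r → Part n r → ℚ → Set
InNbhd {n} {r} W P P' t =
  Σ (Fin r ↔ Fin r) λ σ →
    toℚ (count (λ v → W v ∧ not (P' v == Inverse.to σ (P v)))) ≤ t

eCount : ∀ {n} → Graph n → VSet n → VSet n → ℕ
eCount G U U' = countPairs λ u v → U u ∧ U' v ∧ adj G u v

SubClass : ∀ {n r} → VSet n → Part n r → Fin r → Set
SubClass U Q i = ∀ v → U v ≡ true → Q v ≡ i

F1 : ∀ {n r} → ℚ → Graph n → Part n r → Set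
F1 {n} {r} ν G Q =
  ∀ (i j : Fin r) → i ≢ j → ∀ (Ui Uj : VSet n) →
    SubClass Ui Q i → SubClass Uj Q j →
    (ν * ν) * toℚ (n ℕ.* n) ≤ toℚ (count Ui ℕ.* count Uj) →
    -- 1/4 ≤ e(Ui,Uj)/(|Ui||Uj|) ≤ 3/4, denominators cleared
    (count Ui ℕ.* count Uj ℕ.≤ 4 ℕ.* eCount G Ui Uj) ×
    (4 ℕ.* eCount G Ui Uj ℕ.≤ 3 ℕ.* (count Ui ℕ.* count Uj))

-- (F2)_μ with respect to Q, where r = k-1:
--   | |Q_i| - n/r | ≤ μ n , written with denominators cleared as
--   | r |Q_i| - n | ≤ μ n r
F2 : ∀ {n r} → ℚ → Part n r → Set
F2 {n} {r} μ Q =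
  ∀ (i : Fin r) →
    ∣ toℚ (r ℕ.* count (λ v → Q v == i)) - toℚ n ∣ ≤ μ * toℚ (n ℕ.* r)

FQ : ∀ {n} (k : ℕ) → ℚ → Part n (k ∸ 1) → Graph n → Set
FQ {n} k η Q G =
  (¬C (HasInducedCycle (2 ℕ.* k) G)) × Optimal full G Q × (toℚ (h full G Q) ≤ η * toℚ (n ℕ.* n))
  where
    open import Data.Empty using (⊥)
    ¬C : Set → Set
    ¬C A = A → ⊥

FQμ : ∀ {n} (k : ℕ) → ℚ → ℚ → Part n (k ∸ 1) → Graph n → Set
FQμ k η μ Q G = FQ k η Q G × F1 μ G Q × F2 μ Q

module Submission where

-- Write r = k - 1, W = [n] \ S, and for classes i, l call U(i,l) = W ∩ Q_i ∩ P_l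
-- a cell, of size a(i,l).  Only (F1)_ν, (F2)_μ, the optimality of P and the
-- bound m on internal non-edges are needed; n₀ = 1 and k ≥ 2 suffice.
--  (1) P is optimal for G - S, so h(P) ≤ h(Q - S) ≤ h(Q) ≤ m and 4 h(P) < ν²n².
--  (2) For i ≠ j the cells U(i,l), U(j,l) lie in one class of P, so their
--      non-edges are internal non-edges of P.  If a(i,l) a(j,l) ≥ ν²n², (F1)_ν
--      makes a quarter of these pairs non-edges, so a(i,l) a(j,l) ≤ 4 h(P):
--      a contradiction with (1).  Hence all such products are below ν²n².
--  (3) By (F2)_μ and |S| ≤ n/k², the largest cell U(i, f i) of Q_i has
--      c₁ n ≤ c₂ a(i, f i), where c₁ = k³ - r(k + 1) and c₂ = k³ r²,
--      in particular n ≤ k³ a(i, f i); with ν k³ ≤ 1 and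
--      (2), f is injective and hence a permutation σ of the classes.
--  (4) The vertices moved relative to σ are those in cells U(j,l) with l ≠ f j;
--      then l = f i for an i ≠ j, and (2), (3) bound a(j,l) c₁ n by c₂ ν²n².
--      Summing over the r² cells gives at most k⁴ ν² n moved vertices.

open import Defs
open import Data.Nat using (ℕ; suc; s≤s; _≤_; _*_; _^_; _∸_)
open import Data.Fin using (Fin)
open import Data.Rational using (ℚ; 0ℚ; 1ℚ) renaming (_≤_ to _≤ℚ_; _<_ to _<ℚ_; _*_ to _*ℚ_)
open import Data.Product using (Σ; _,_; proj₂)

module NatEmbedding where

  open import Data.Nat as ℕ using (ℕ; zero; suc)
  open import Data.Integer as ℤ using (+_; +≤+; +<+)
  import Data.Integer.Properties as ℤP
  open import Data.Rational as ℚ using (ℚ; mkℚ; 0ℚ; 1ℚ; *≤*; *<*)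
  import Data.Rational.Properties as ℚP
  import Data.Nat.Coprimality as Coprime
  open import Data.Fin using (Fin) renaming (zero to fzero; suc to fsuc)
  open import Data.Sum using (inj₁; inj₂)
  open import Data.Empty using (⊥)
  open import Data.Rational.Solver using (module +-*-Solver)
  open +-*-Solver
  open import Relation.Binary.PropositionalEquality hiding (sym)
  import Relation.Binary.PropositionalEquality as ≡

  -- toℚ n is already in normal form, which exposes its numerator to proofs.
  toℚ-normal : ∀ n → toℚ n ≡ mkℚ (+ n) 0 (Coprime.sym (Coprime.1-coprimeTo n))
  toℚ-normal n = ℚP.normalize-coprime (Coprime.sym (Coprime.1-coprimeTo n))

  toℚ-mono : ∀ {a b} → a ℕ.≤ b → toℚ a ℚ.≤ toℚ b
  toℚ-mono {a} {b} a≤b rewrite toℚ-normal a | toℚ-normal b =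
    *≤* (subst₂ ℤ._≤_ (≡.sym (ℤP.*-identityʳ (+ a))) (≡.sym (ℤP.*-identityʳ (+ b))) (+≤+ a≤b))

  toℚ-strictMono : ∀ {a b} → a ℕ.< b → toℚ a ℚ.< toℚ b
  toℚ-strictMono {a} {b} a<b rewrite toℚ-normal a | toℚ-normal b =
    *<* (subst₂ ℤ._<_ (≡.sym (ℤP.*-identityʳ (+ a))) (≡.sym (ℤP.*-identityʳ (+ b))) (+<+ a<b))

  toℚ-cancel : ∀ {a b} → toℚ a ℚ.≤ toℚ b → a ℕ.≤ b
  toℚ-cancel {a} {b} p rewrite toℚ-normal a | toℚ-normal b with p
  ... | *≤* q = ℤP.drop‿+≤+ (subst₂ ℤ._≤_ (ℤP.*-identityʳ (+ a)) (ℤP.*-identityʳ (+ b)) q)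

  toℚ-+ : ∀ a b → toℚ (a ℕ.+ b) ≡ toℚ a ℚ.+ toℚ b
  toℚ-+ a b rewrite toℚ-normal a | toℚ-normal b =
    ℚP./-cong {p₁ = + (a ℕ.+ b)}
      (≡.sym (cong₂ ℤ._+_ (ℤP.*-identityʳ (+ a)) (ℤP.*-identityʳ (+ b)))) refl

  toℚ-* : ∀ a b → toℚ (a ℕ.* b) ≡ toℚ a ℚ.* toℚ b
  toℚ-* a b rewrite toℚ-normal a | toℚ-normal b =
    ℚP./-cong {p₁ = + (a ℕ.* b)} (ℤP.pos-* a b) refl

  toℚ-nonNeg : ∀ a → 0ℚ ℚ.≤ toℚ a
  toℚ-nonNeg a = toℚ-mono {0} {a} ℕ.z≤n

  *-nonNeg : ∀ {p q} → 0ℚ ℚ.≤ p → 0ℚ ℚ.≤ q → 0ℚ ℚ.≤ p ℚ.* q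
  *-nonNeg {p} {q} 0≤p 0≤q =
    ℚP.nonNegative⁻¹ _ {{ℚP.nonNeg*nonNeg⇒nonNeg p {{ℚ.nonNegative 0≤p}} q {{ℚ.nonNegative 0≤q}}}}

  neg≤abs : ∀ p → ℚ.- p ℚ.≤ ℚ.∣ p ∣
  neg≤abs p with ℚP.∣p∣≡p∨∣p∣≡-p p
  ... | inj₂ ∣p∣≡-p = ℚP.≤-reflexive (≡.sym ∣p∣≡-p)
  ... | inj₁ ∣p∣≡p  = ℚP.≤-trans (ℚP.neg-antimono-≤ (ℚP.∣p∣≡p⇒0≤p ∣p∣≡p)) (ℚP.0≤∣p∣ p)

  scaled-≤ : ∀ (ν : ℚ) (K n a : ℕ) → 0ℚ ℚ.≤ ν → ν ℚ.* toℚ K ℚ.≤ 1ℚ → n ℕ.≤ K ℕ.* a →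
             ν ℚ.* toℚ n ℚ.≤ toℚ a
  scaled-≤ ν K n a 0≤ν νK≤1 n≤Ka = begin
      ν ℚ.* toℚ n               ≤⟨ ℚP.*-monoˡ-≤-nonNeg ν (toℚ-mono n≤Ka) ⟩
      ν ℚ.* toℚ (K ℕ.* a)       ≡⟨ cong (ν ℚ.*_) (toℚ-* K a) ⟩
      ν ℚ.* (toℚ K ℚ.* toℚ a)   ≡⟨ ≡.sym (ℚP.*-assoc ν (toℚ K) (toℚ a)) ⟩
      (ν ℚ.* toℚ K) ℚ.* toℚ a   ≤⟨ ℚP.*-monoʳ-≤-nonNeg (toℚ a) νK≤1 ⟩
      1ℚ ℚ.* toℚ a              ≡⟨ ℚP.*-identityˡ (toℚ a) ⟩
      toℚ a                     ∎
    where
    open ℚP.≤-Reasoning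
    instance
      ν-nonNeg : ℚ.NonNegative ν
      ν-nonNeg = ℚ.nonNegative 0≤ν
      a-nonNeg : ℚ.NonNegative (toℚ a)
      a-nonNeg = ℚ.nonNegative (toℚ-nonNeg a)

  -- If ν K ≤ 1 and n ≤ K a, n ≤ K b, then ν² n² ≤ a b: the product of two
  -- sets of size at least n/K is above the (F1)_ν threshold.
  product-above-threshold :
    ∀ (ν : ℚ) (K n a b : ℕ) → 0ℚ ℚ.≤ ν → ν ℚ.* toℚ K ℚ.≤ 1ℚ →
    n ℕ.≤ K ℕ.* a → n ℕ.≤ K ℕ.* b → (ν ℚ.* ν) ℚ.* toℚ (n ℕ.* n) ℚ.≤ toℚ (a ℕ.* b)
  product-above-threshold ν K n a b 0≤ν νK≤1 n≤Ka n≤Kb = begin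
      (ν ℚ.* ν) ℚ.* toℚ (n ℕ.* n)       ≡⟨ cong ((ν ℚ.* ν) ℚ.*_) (toℚ-* n n) ⟩
      (ν ℚ.* ν) ℚ.* (toℚ n ℚ.* toℚ n)   ≡⟨ solve 2 (λ ν x → (ν :* ν) :* (x :* x) := (ν :* x) :* (ν :* x)) refl ν (toℚ n) ⟩
      (ν ℚ.* toℚ n) ℚ.* (ν ℚ.* toℚ n)   ≤⟨ ℚP.*-monoʳ-≤-nonNeg (ν ℚ.* toℚ n) (scaled-≤ ν K n a 0≤ν νK≤1 n≤Ka) ⟩
      toℚ a ℚ.* (ν ℚ.* toℚ n)           ≤⟨ ℚP.*-monoˡ-≤-nonNeg (toℚ a) (scaled-≤ ν K n b 0≤ν νK≤1 n≤Kb) ⟩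
      toℚ a ℚ.* toℚ b                   ≡⟨ ≡.sym (toℚ-* a b) ⟩
      toℚ (a ℕ.* b)                     ∎
    where
    open ℚP.≤-Reasoning
    instance
      νn-nonNeg : ℚ.NonNegative (ν ℚ.* toℚ n)
      νn-nonNeg = ℚ.nonNegative (*-nonNeg 0≤ν (toℚ-nonNeg n))
      a-nonNeg : ℚ.NonNegative (toℚ a)
      a-nonNeg = ℚ.nonNegative (toℚ-nonNeg a)

  four-times-below : ∀ (T m : ℚ) (x y : ℕ) → x ℕ.≤ y → toℚ y ℚ.≤ m →
                     toℚ 4 ℚ.* m ℚ.< T → toℚ (4 ℕ.* x) ℚ.< T
  four-times-below T m x y x≤y y≤m 4m<T = ℚP.≤-<-trans 4x≤4m 4m<T
    where
    instance
      4-nonNeg : ℚ.NonNegative (toℚ 4)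
      4-nonNeg = ℚ.nonNegative (toℚ-nonNeg 4)
    4x≤4m : toℚ (4 ℕ.* x) ℚ.≤ toℚ 4 ℚ.* m
    4x≤4m = subst (ℚ._≤ toℚ 4 ℚ.* m) (≡.sym (toℚ-* 4 x))
              (ℚP.*-monoˡ-≤-nonNeg (toℚ 4) (ℚP.≤-trans (toℚ-mono x≤y) y≤m))

  below-threshold : ∀ (Y : ℚ) (N C x t : ℕ) → 0ℚ ℚ.≤ Y →
                    (Y ℚ.* toℚ N ℚ.≤ toℚ x → ⊥) → t ℕ.≤ C ℕ.* x →
                    toℚ t ℚ.≤ Y ℚ.* toℚ (C ℕ.* N)
  below-threshold Y N C x t 0≤Y x<YN t≤Cx = begin
      toℚ t                       ≤⟨ toℚ-mono t≤Cx ⟩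
      toℚ (C ℕ.* x)               ≡⟨ toℚ-* C x ⟩
      toℚ C ℚ.* toℚ x             ≤⟨ ℚP.*-monoˡ-≤-nonNeg (toℚ C) (ℚP.<⇒≤ (ℚP.≰⇒> x<YN)) ⟩
      toℚ C ℚ.* (Y ℚ.* toℚ N)     ≡⟨ solve 3 (λ c y m → c :* (y :* m) := y :* (c :* m)) refl (toℚ C) Y (toℚ N) ⟩
      Y ℚ.* (toℚ C ℚ.* toℚ N)     ≡⟨ cong (Y ℚ.*_) (≡.sym (toℚ-* C N)) ⟩
      Y ℚ.* toℚ (C ℕ.* N)         ∎
    where
    open ℚP.≤-Reasoning
    instance
      C-nonNeg : ℚ.NonNegative (toℚ C)
      C-nonNeg = ℚ.nonNegative (toℚ-nonNeg C)

  sumFin-≤-scaled : ∀ {r} (Y : ℚ) (B : ℕ) (f : Fin r → ℕ) → (∀ i → toℚ (f i) ℚ.≤ Y ℚ.* toℚ B) →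
                    toℚ (sumFin f) ℚ.≤ Y ℚ.* toℚ (r ℕ.* B)
  sumFin-≤-scaled {zero} Y B f _ = ℚP.≤-reflexive (≡.sym (ℚP.*-zeroʳ Y))
  sumFin-≤-scaled {suc r} Y B f bound = begin
      toℚ (f fzero ℕ.+ sumFin (λ i → f (fsuc i)))          ≡⟨ toℚ-+ (f fzero) _ ⟩
      toℚ (f fzero) ℚ.+ toℚ (sumFin (λ i → f (fsuc i)))    ≤⟨ ℚP.+-mono-≤ (bound fzero) rest ⟩
      Y ℚ.* toℚ B ℚ.+ Y ℚ.* toℚ (r ℕ.* B)                 ≡⟨ ≡.sym (ℚP.*-distribˡ-+ Y (toℚ B) _) ⟩
      Y ℚ.* (toℚ B ℚ.+ toℚ (r ℕ.* B))                     ≡⟨ cong (Y ℚ.*_) (≡.sym (toℚ-+ B (r ℕ.* B))) ⟩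
      Y ℚ.* toℚ (suc r ℕ.* B)                              ∎
    where
    open ℚP.≤-Reasoning
    rest : toℚ (sumFin (λ i → f (fsuc i))) ℚ.≤ Y ℚ.* toℚ (r ℕ.* B)
    rest = sumFin-≤-scaled Y B (λ i → f (fsuc i)) (λ i → bound (fsuc i))

  cancel-positive : ∀ (Y : ℚ) (D c E K n : ℕ) → 0ℚ ℚ.≤ Y → toℚ (D ℕ.* c) ℚ.≤ Y ℚ.* toℚ E →
                    E ℕ.≤ (K ℕ.* n) ℕ.* c → 0 ℕ.< c → toℚ D ℚ.≤ toℚ K ℚ.* Y ℚ.* toℚ n
  cancel-positive Y D c E K n 0≤Y Dc≤YE E≤Knc 0<c = ℚP.*-cancelʳ-≤-pos (toℚ c) (begin
      toℚ D ℚ.* toℚ c                     ≡⟨ ≡.sym (toℚ-* D c) ⟩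
      toℚ (D ℕ.* c)                       ≤⟨ Dc≤YE ⟩
      Y ℚ.* toℚ E                         ≤⟨ ℚP.*-monoˡ-≤-nonNeg Y (toℚ-mono E≤Knc) ⟩
      Y ℚ.* toℚ ((K ℕ.* n) ℕ.* c)         ≡⟨ cong (Y ℚ.*_) (trans (toℚ-* (K ℕ.* n) c) (cong (ℚ._* toℚ c) (toℚ-* K n))) ⟩
      Y ℚ.* ((toℚ K ℚ.* toℚ n) ℚ.* toℚ c) ≡⟨ solve 4 (λ y a b c → y :* ((a :* b) :* c) := ((a :* y) :* b) :* c) refl Y (toℚ K) (toℚ n) (toℚ c) ⟩
      (toℚ K ℚ.* Y ℚ.* toℚ n) ℚ.* toℚ c   ∎)
    where
    open ℚP.≤-Reasoning
    instance
      Y-nonNeg : ℚ.NonNegative Y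
      Y-nonNeg = ℚ.nonNegative 0≤Y
      c-pos : ℚ.Positive (toℚ c)
      c-pos = ℚ.positive (toℚ-strictMono {0} {c} 0<c)

  approx-lower : ∀ (μ : ℚ) (K A n B : ℕ) → 0ℚ ℚ.≤ μ → μ ℚ.* toℚ K ℚ.≤ 1ℚ →
                 ℚ.∣ toℚ A ℚ.- toℚ n ∣ ℚ.≤ μ ℚ.* toℚ B → K ℕ.* n ℕ.≤ K ℕ.* A ℕ.+ B
  approx-lower μ K A n B 0≤μ μK≤1 close = toℚ-cancel (begin
      toℚ (K ℕ.* n)                                 ≡⟨ toℚ-* K n ⟩
      toℚ K ℚ.* toℚ n                               ≡⟨ cong (toℚ K ℚ.*_) (solve 2 (λ a m → m := a :+ (:- (a :- m))) refl (toℚ A) (toℚ n)) ⟩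
      toℚ K ℚ.* (toℚ A ℚ.+ ℚ.- (toℚ A ℚ.- toℚ n))   ≤⟨ ℚP.*-monoˡ-≤-nonNeg (toℚ K) (ℚP.+-monoʳ-≤ (toℚ A) (ℚP.≤-trans (neg≤abs _) close)) ⟩
      toℚ K ℚ.* (toℚ A ℚ.+ μ ℚ.* toℚ B)             ≡⟨ solve 4 (λ k a m b → k :* (a :+ m :* b) := k :* a :+ (m :* k) :* b) refl (toℚ K) (toℚ A) μ (toℚ B) ⟩
      toℚ K ℚ.* toℚ A ℚ.+ (μ ℚ.* toℚ K) ℚ.* toℚ B   ≤⟨ ℚP.+-monoʳ-≤ (toℚ K ℚ.* toℚ A) (ℚP.*-monoʳ-≤-nonNeg (toℚ B) μK≤1) ⟩
      toℚ K ℚ.* toℚ A ℚ.+ 1ℚ ℚ.* toℚ B              ≡⟨ cong₂ ℚ._+_ (≡.sym (toℚ-* K A)) (ℚP.*-identityˡ (toℚ B)) ⟩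
      toℚ (K ℕ.* A) ℚ.+ toℚ B                       ≡⟨ ≡.sym (toℚ-+ (K ℕ.* A) B) ⟩
      toℚ (K ℕ.* A ℕ.+ B)                           ∎)
    where
    open ℚP.≤-Reasoning
    instance
      K-nonNeg : ℚ.NonNegative (toℚ K)
      K-nonNeg = ℚ.nonNegative (toℚ-nonNeg K)
      B-nonNeg : ℚ.NonNegative (toℚ B)
      B-nonNeg = ℚ.nonNegative (toℚ-nonNeg B)

module Counting where

  open import Data.Bool using (Bool; true; false; _∧_; if_then_else_)
  open import Data.Nat as ℕ using (ℕ; zero; suc; _+_; _*_; _≤_; z≤n)
  import Data.Nat.Properties as ℕP
  open import Data.Fin using (Fin; punchOut) renaming (zero to fzero; suc to fsuc)
  import Data.Fin.Properties as FinP
  open import Data.Product using (Σ; _,_)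
  open import Data.Sum using (inj₁; inj₂)
  open import Data.Empty using (⊥-elim)
  open import Relation.Nullary using (Dec; yes; no)
  open import Algebra.Properties.Semiring.Sum ℕP.+-*-semiring
    using (sum; ∑-comm; ∑-distrib-+; *-distribˡ-sum; *-distribʳ-sum)
  open import Relation.Binary.PropositionalEquality hiding (sym)
  import Relation.Binary.PropositionalEquality as ≡
  open ≡-Reasoning

  ind : Bool → ℕ
  ind b = if b then 1 else 0

  ind-∧ : ∀ a b → ind (a ∧ b) ≡ ind a * ind b
  ind-∧ true  b = ≡.sym (ℕP.+-identityʳ (ind b))
  ind-∧ false b = refl

  ind≤1 : ∀ b → ind b ≤ 1
  ind≤1 true  = ℕP.≤-refl
  ind≤1 false = z≤n

  sumFin-cong : ∀ {n} {f g : Fin n → ℕ} → (∀ i → f i ≡ g i) → sumFin f ≡ sumFin g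
  sumFin-cong {zero}  f≗g = refl
  sumFin-cong {suc n} f≗g = cong₂ _+_ (f≗g fzero) (sumFin-cong (λ i → f≗g (fsuc i)))

  sumFin-zero : ∀ {n} {f : Fin n → ℕ} → (∀ i → f i ≡ 0) → sumFin f ≡ 0
  sumFin-zero {zero}  f≗0 = refl
  sumFin-zero {suc n} f≗0 = cong₂ _+_ (f≗0 fzero) (sumFin-zero (λ i → f≗0 (fsuc i)))

  -- sumFin agrees with the library's finite sum over the semiring ℕ,
  -- which lets us use its algebraic laws.
  sumFin≡sum : ∀ {n} (f : Fin n → ℕ) → sumFin f ≡ sum f
  sumFin≡sum {zero}  f = refl
  sumFin≡sum {suc n} f = cong (f fzero +_) (sumFin≡sum (λ i → f (fsuc i)))

  sumFin-+ : ∀ {n} (f g : Fin n → ℕ) → sumFin (λ i → f i + g i) ≡ sumFin f + sumFin g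
  sumFin-+ f g = begin
    sumFin (λ i → f i + g i) ≡⟨ sumFin≡sum (λ i → f i + g i) ⟩
    sum (λ i → f i + g i)    ≡⟨ ∑-distrib-+ f g ⟩
    sum f + sum g            ≡⟨ ≡.sym (cong₂ _+_ (sumFin≡sum f) (sumFin≡sum g)) ⟩
    sumFin f + sumFin g      ∎

  sumFin-*ˡ : ∀ {n} (c : ℕ) (f : Fin n → ℕ) → sumFin (λ i → c * f i) ≡ c * sumFin f
  sumFin-*ˡ c f = begin
    sumFin (λ i → c * f i) ≡⟨ sumFin≡sum (λ i → c * f i) ⟩
    sum (λ i → c * f i)    ≡⟨ ≡.sym (*-distribˡ-sum c f) ⟩
    c * sum f              ≡⟨ cong (c *_) (≡.sym (sumFin≡sum f)) ⟩
    c * sumFin f           ∎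

  sumFin-*ʳ : ∀ {n} (c : ℕ) (f : Fin n → ℕ) → sumFin (λ i → f i * c) ≡ sumFin f * c
  sumFin-*ʳ c f = begin
    sumFin (λ i → f i * c) ≡⟨ sumFin≡sum (λ i → f i * c) ⟩
    sum (λ i → f i * c)    ≡⟨ ≡.sym (*-distribʳ-sum c f) ⟩
    sum f * c              ≡⟨ cong (_* c) (≡.sym (sumFin≡sum f)) ⟩
    sumFin f * c           ∎

  sumFin-swap : ∀ {n m} (f : Fin n → Fin m → ℕ) →
                sumFin (λ i → sumFin (λ j → f i j)) ≡ sumFin (λ j → sumFin (λ i → f i j))
  sumFin-swap f = begin
    sumFin (λ i → sumFin (f i))          ≡⟨ sumFin-cong (λ i → sumFin≡sum (f i)) ⟩
    sumFin (λ i → sum (f i))             ≡⟨ sumFin≡sum (λ i → sum (f i)) ⟩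
    sum (λ i → sum (f i))                ≡⟨ ∑-comm f ⟩
    sum (λ j → sum (λ i → f i j))        ≡⟨ ≡.sym (sumFin≡sum (λ j → sum (λ i → f i j))) ⟩
    sumFin (λ j → sum (λ i → f i j))     ≡⟨ sumFin-cong (λ j → ≡.sym (sumFin≡sum (λ i → f i j))) ⟩
    sumFin (λ j → sumFin (λ i → f i j))  ∎

  sumFin-mono : ∀ {n} {f g : Fin n → ℕ} → (∀ i → f i ≤ g i) → sumFin f ≤ sumFin g
  sumFin-mono {zero}  f≤g = z≤n
  sumFin-mono {suc n} f≤g = ℕP.+-mono-≤ (f≤g fzero) (sumFin-mono (λ i → f≤g (fsuc i)))

  sumFin-≤ : ∀ {n} (c : ℕ) (f : Fin n → ℕ) → (∀ i → f i ≤ c) → sumFin f ≤ n * c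
  sumFin-≤ {zero}  c f f≤c = z≤n
  sumFin-≤ {suc n} c f f≤c = ℕP.+-mono-≤ (f≤c fzero) (sumFin-≤ c (λ i → f (fsuc i)) (λ i → f≤c (fsuc i)))

  count-sum : ∀ {n} (p : Fin n → Bool) → count p ≡ sumFin (λ i → ind (p i))
  count-sum {zero}  p = refl
  count-sum {suc n} p = cong (ind (p fzero) +_) (count-sum (λ i → p (fsuc i)))

  count-mono : ∀ {n} {p q : Fin n → Bool} → (∀ i → ind (p i) ≤ ind (q i)) → count p ≤ count q
  count-mono {p = p} {q} p≤q =
    subst₂ _≤_ (≡.sym (count-sum p)) (≡.sym (count-sum q)) (sumFin-mono p≤q)

  countPairs-sum : ∀ {n} (p : Fin n → Fin n → Bool) →
                   countPairs p ≡ sumFin (λ i → sumFin (λ j → ind (p i j)))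
  countPairs-sum p = sumFin-cong (λ i → count-sum (p i))

  argmax : ∀ {m} (g : Fin (suc m) → ℕ) → Σ (Fin (suc m)) λ l → ∀ l' → g l' ≤ g l
  argmax {zero} g = fzero , λ { fzero → ℕP.≤-refl }
  argmax {suc m} g with argmax (λ i → g (fsuc i))
  ... | l , max with ℕP.≤-total (g fzero) (g (fsuc l))
  ...   | inj₁ g0≤ = fsuc l , λ { fzero → g0≤    ; (fsuc i) → max i }
  ...   | inj₂ ≤g0 = fzero  , λ { fzero → ℕP.≤-refl ; (fsuc i) → ℕP.≤-trans (max i) ≤g0 }

  injective⇒surjective : ∀ {m} (f : Fin m → Fin m) → (∀ {x y} → f x ≡ f y → x ≡ y) →
                         ∀ y → Σ (Fin m) λ x → f x ≡ y
  injective⇒surjective {suc m} f inj y with FinP.any? (λ x → f x FinP.≟ y)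
  ... | yes hit = hit
  ... | no miss = ⊥-elim (ℕP.1+n≰n (FinP.injective⇒≤ {f = squeeze} squeeze-injective))
    where
    y∉image : ∀ x → y ≢ f x
    y∉image x y≡fx = miss (x , ≡.sym y≡fx)
    -- f with y removed from its codomain
    squeeze : Fin (suc m) → Fin m
    squeeze x = punchOut (y∉image x)
    squeeze-injective : ∀ {x z} → squeeze x ≡ squeeze z → x ≡ z
    squeeze-injective e = inj (FinP.punchOut-injective (y∉image _) (y∉image _) e)

  ==-refl : ∀ {r} (x : Fin r) → (x == x) ≡ true
  ==-refl x with x FinP.≟ x
  ... | yes _ = refl
  ... | no x≢x = ⊥-elim (x≢x refl)

  ==⇒≡ : ∀ {r} {x y : Fin r} → (x == y) ≡ true → x ≡ y
  ==⇒≡ {x = x} {y} e with x FinP.≟ y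
  ... | yes x≡y = x≡y

  ≡⇒== : ∀ {r} {x y : Fin r} → x ≡ y → (x == y) ≡ true
  ≡⇒== {x = x} refl = ==-refl x

  ==-false : ∀ {r} {x y : Fin r} → x ≢ y → (x == y) ≡ false
  ==-false {x = x} {y} x≢y with x FinP.≟ y
  ... | yes x≡y = ⊥-elim (x≢y x≡y)
  ... | no _ = refl

  ==-suc : ∀ {r} (x y : Fin r) → (fsuc x == fsuc y) ≡ (x == y)
  ==-suc x y = by-cases (x FinP.≟ y)
    where
    by-cases : Dec (x ≡ y) → (fsuc x == fsuc y) ≡ (x == y)
    by-cases (yes x≡y) = trans (≡⇒== (cong fsuc x≡y)) (≡.sym (≡⇒== x≡y))
    by-cases (no x≢y)  = trans (==-false (λ e → x≢y (FinP.suc-injective e))) (≡.sym (==-false x≢y))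

  sumFin-select : ∀ {r} (x : Fin r) (H : Fin r → ℕ) → sumFin (λ j → ind (x == j) * H j) ≡ H x
  sumFin-select {suc r} fzero H = begin
    ind (fzero {r} == fzero) * H fzero + sumFin (λ j → ind (fzero == fsuc j) * H (fsuc j))
      ≡⟨ cong₂ _+_ (cong (λ b → ind b * H fzero) (==-refl (fzero {r})))
                   (sumFin-zero (λ j → cong (λ b → ind b * H (fsuc j)) (==-false {x = fzero} {fsuc j} (λ ())))) ⟩
    1 * H fzero + 0
      ≡⟨ ℕP.+-identityʳ (1 * H fzero) ⟩
    1 * H fzero
      ≡⟨ ℕP.*-identityˡ (H fzero) ⟩
    H fzero ∎
  sumFin-select {suc r} (fsuc x) H = begin
    ind (fsuc x == fzero) * H fzero + sumFin (λ j → ind (fsuc x == fsuc j) * H (fsuc j))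
      ≡⟨ cong₂ _+_ (cong (λ b → ind b * H fzero) (==-false {x = fsuc x} {fzero} (λ ())))
                   (sumFin-cong (λ j → cong (λ b → ind b * H (fsuc j)) (==-suc x j))) ⟩
    0 + sumFin (λ j → ind (x == j) * H (fsuc j))
      ≡⟨ sumFin-select x (λ j → H (fsuc j)) ⟩
    H (fsuc x) ∎

module Cells where

  open import Data.Bool using (Bool; true; false; _∧_; not)
  open import Data.Bool.Properties using (∧-conicalˡ; ∧-conicalʳ; not-involutive; T-≡)
  open import Data.Nat as ℕ using (ℕ; _+_; _*_; _≤_; _<ᵇ_; z≤n; s≤s)
  import Data.Nat.Properties as ℕP
  open import Data.Nat.Solver using (module +-*-Solver)
  open +-*-Solver
  open import Data.Fin using (Fin; toℕ)
  import Data.Fin.Properties as FinP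
  open import Data.Empty using (⊥; ⊥-elim)
  open import Function.Bundles using (Equivalence)
  open import Relation.Binary.Definitions using (tri<; tri≈; tri>)
  open import Relation.Binary.PropositionalEquality hiding (sym)
  import Relation.Binary.PropositionalEquality as ≡
  open ≡-Reasoning
  open Counting

  nonEdge : ∀ {n} → Graph n → VSet n → VSet n → Fin n → Fin n → Bool
  nonEdge G X Y u v = X u ∧ Y v ∧ not (adj G u v)

  nonEdges : ∀ {n} → Graph n → VSet n → VSet n → ℕ
  nonEdges G X Y = countPairs (nonEdge G X Y)

  internalNonEdge : ∀ {n r} → VSet n → Graph n → Part n r → Fin n → Fin n → Bool
  internalNonEdge W G P u v = (toℕ u <ᵇ toℕ v) ∧ W u ∧ W v ∧ (P u == P v) ∧ not (adj G u v)

  pairs-split : ∀ {n} (G : Graph n) (X Y : VSet n) →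
                count X * count Y ≡ eCount G X Y + nonEdges G X Y
  pairs-split {n} G X Y = begin
    count X * count Y
      ≡⟨ cong₂ _*_ (count-sum X) (count-sum Y) ⟩
    sumFin (λ u → ind (X u)) * sumFin (λ v → ind (Y v))
      ≡⟨ ≡.sym (sumFin-*ʳ _ (λ u → ind (X u))) ⟩
    sumFin (λ u → ind (X u) * sumFin (λ v → ind (Y v)))
      ≡⟨ sumFin-cong (λ u → ≡.sym (sumFin-*ˡ (ind (X u)) (λ v → ind (Y v)))) ⟩
    sumFin (λ u → sumFin (λ v → ind (X u) * ind (Y v)))
      ≡⟨ sumFin-cong (λ u → sumFin-cong (λ v → edge-or-not (X u) (Y v) (adj G u v))) ⟩
    sumFin (λ u → sumFin (λ v → ind (edge u v) + ind (nonEdge G X Y u v)))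
      ≡⟨ sumFin-cong (λ u → sumFin-+ (λ v → ind (edge u v)) (λ v → ind (nonEdge G X Y u v))) ⟩
    sumFin (λ u → sumFin (λ v → ind (edge u v)) + sumFin (λ v → ind (nonEdge G X Y u v)))
      ≡⟨ sumFin-+ (λ u → sumFin (λ v → ind (edge u v))) (λ u → sumFin (λ v → ind (nonEdge G X Y u v))) ⟩
    sumFin (λ u → sumFin (λ v → ind (edge u v))) + sumFin (λ u → sumFin (λ v → ind (nonEdge G X Y u v)))
      ≡⟨ ≡.sym (cong₂ _+_ (countPairs-sum edge) (countPairs-sum (nonEdge G X Y))) ⟩
    eCount G X Y + nonEdges G X Y ∎
    where
    edge : Fin n → Fin n → Bool
    edge u v = X u ∧ Y v ∧ adj G u v
    edge-or-not : ∀ x y a → ind x * ind y ≡ ind (x ∧ y ∧ a) + ind (x ∧ y ∧ not a)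
    edge-or-not true  true  true  = refl
    edge-or-not true  true  false = refl
    edge-or-not true  false a     = refl
    edge-or-not false y     a     = refl

  quarter-nonEdges : ∀ {n} (G : Graph n) (X Y : VSet n) →
                     4 * eCount G X Y ≤ 3 * (count X * count Y) →
                     count X * count Y ≤ 4 * nonEdges G X Y
  quarter-nonEdges G X Y few-edges rewrite pairs-split G X Y = quarter (eCount G X Y) (nonEdges G X Y) few-edges
    where
    quarter : ∀ e N → 4 * e ≤ 3 * (e + N) → e + N ≤ 4 * N
    quarter e N 4e≤3[e+N] = subst (e + N ≤_) (solve 1 (λ N → con 3 :* N :+ N := con 4 :* N) refl N)
                              (ℕP.+-monoˡ-≤ N e≤3N)
      where
      e≤3N : e ≤ 3 * N
      e≤3N = ℕP.+-cancelˡ-≤ (3 * e) e (3 * N)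
               (subst₂ _≤_ (solve 1 (λ e → con 4 :* e := con 3 :* e :+ e) refl e)
                           (solve 2 (λ e N → con 3 :* (e :+ N) := con 3 :* e :+ con 3 :* N) refl e N)
                           4e≤3[e+N])

  h-deletion : ∀ {n r} (W : VSet n) (G : Graph n) (P : Part n r) → h W G P ≤ h full G P
  h-deletion W G P = sumFin-mono (λ u → count-mono (λ v → drop-W (toℕ u <ᵇ toℕ v) (W u) (W v) _))
    where
    drop-W : ∀ a b c d → ind (a ∧ b ∧ c ∧ d) ≤ ind (a ∧ true ∧ true ∧ d)
    drop-W true  true  true  d = ℕP.≤-refl
    drop-W true  true  false d = z≤n
    drop-W true  false c     d = z≤n
    drop-W false b     c     d = z≤n

  internal-pair : ∀ {n r} (W : VSet n) (G : Graph n) (P : Part n r) {u v : Fin n} →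
                  toℕ u ℕ.< toℕ v → W u ≡ true → W v ≡ true → P u ≡ P v → adj G u v ≡ false →
                  internalNonEdge W G P u v ≡ true
  internal-pair W G P u<v Wu Wv Pu≡Pv uv∉E
    rewrite Equivalence.to T-≡ (ℕP.<⇒<ᵇ u<v) | Wu | Wv | ≡⇒== Pu≡Pv | uv∉E = refl

  -- Let X, Y ⊆ W be disjoint and contained in a single class of P.  Then every
  -- non-edge between X and Y is an internal non-edge of P, so
  -- nonEdges(X,Y) ≤ h(P).
  module _ {n r} (G : Graph n) (W X Y : VSet n) (P : Part n r)
           (X⊆W : ∀ v → X v ≡ true → W v ≡ true) (Y⊆W : ∀ v → Y v ≡ true → W v ≡ true)
           (disjoint : ∀ v → X v ≡ true → Y v ≡ true → ⊥)
           (one-class : ∀ u v → X u ≡ true → Y v ≡ true → P u ≡ P v) where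

    private
      I : Fin n → Fin n → Bool
      I = internalNonEdge W G P

      in-X : ∀ {u v} → nonEdge G X Y u v ≡ true → X u ≡ true
      in-X {u} {v} e = ∧-conicalˡ (X u) _ e
      in-Y : ∀ {u v} → nonEdge G X Y u v ≡ true → Y v ≡ true
      in-Y {u} {v} e = ∧-conicalˡ (Y v) _ (∧-conicalʳ (X u) _ e)
      non-adjacent : ∀ {u v} → nonEdge G X Y u v ≡ true → adj G u v ≡ false
      non-adjacent {u} {v} e = trans (≡.sym (not-involutive (adj G u v)))
        (cong not (∧-conicalʳ (Y v) _ (∧-conicalʳ (X u) _ e)))

      internal-uv : ∀ {u v} → nonEdge G X Y u v ≡ true → toℕ u ℕ.< toℕ v → I u v ≡ true
      internal-uv e u<v = internal-pair W G P u<v (X⊆W _ (in-X e)) (Y⊆W _ (in-Y e))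
                            (one-class _ _ (in-X e) (in-Y e)) (non-adjacent e)
      internal-vu : ∀ {u v} → nonEdge G X Y u v ≡ true → toℕ v ℕ.< toℕ u → I v u ≡ true
      internal-vu e v<u = internal-pair W G P v<u (Y⊆W _ (in-Y e)) (X⊆W _ (in-X e))
                            (≡.sym (one-class _ _ (in-X e) (in-Y e)))
                            (trans (Graph.sym G _ _) (non-adjacent e))

      counted : ∀ u v → nonEdge G X Y u v ≡ true → 1 ≤ ind (I u v) + ind (I v u)
      counted u v e with ℕP.<-cmp (toℕ u) (toℕ v)
      ... | tri< u<v _ _ rewrite internal-uv e u<v = s≤s z≤n
      ... | tri> _ _ v<u rewrite internal-vu e v<u = ℕP.m≤n+m 1 (ind (I u v))
      ... | tri≈ _ u≡v _ =
        ⊥-elim (disjoint u (in-X e) (subst (λ w → Y w ≡ true) (≡.sym (FinP.toℕ-injective u≡v)) (in-Y e)))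

      pair-bound : ∀ u v → ind (nonEdge G X Y u v) + ind (nonEdge G X Y v u) ≤ ind (I u v) + ind (I v u)
      pair-bound u v with nonEdge G X Y u v in e₁ | nonEdge G X Y v u in e₂
      ... | false | false = z≤n
      ... | true  | false = counted u v e₁
      ... | false | true  = subst (1 ≤_) (ℕP.+-comm (ind (I v u)) (ind (I u v))) (counted v u e₂)
      ... | true  | true  = ⊥-elim (disjoint u (in-X e₁) (in-Y e₂))

    cross-nonEdges≤h : nonEdges G X Y ≤ h W G P
    cross-nonEdges≤h = ℕP.*-cancelˡ-≤ 2
      (subst₂ _≤_ (symmetrised (nonEdge G X Y)) (symmetrised I)
        (sumFin-mono (λ u → sumFin-mono (λ v → pair-bound u v))))
      where
      symmetrised : (p : Fin n → Fin n → Bool) →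
        sumFin (λ u → sumFin (λ v → ind (p u v) + ind (p v u))) ≡ 2 * countPairs p
      symmetrised p = begin
        sumFin (λ u → sumFin (λ v → ind (p u v) + ind (p v u)))
          ≡⟨ sumFin-cong (λ u → sumFin-+ (λ v → ind (p u v)) (λ v → ind (p v u))) ⟩
        sumFin (λ u → sumFin (λ v → ind (p u v)) + sumFin (λ v → ind (p v u)))
          ≡⟨ sumFin-+ (λ u → sumFin (λ v → ind (p u v))) (λ u → sumFin (λ v → ind (p v u))) ⟩
        S + sumFin (λ u → sumFin (λ v → ind (p v u)))
          ≡⟨ cong (S +_) (≡.sym (sumFin-swap (λ v u → ind (p v u)))) ⟩
        S + S
          ≡⟨ cong₂ _+_ (≡.sym (countPairs-sum p)) (≡.sym (countPairs-sum p)) ⟩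
        countPairs p + countPairs p
          ≡⟨ cong (countPairs p +_) (≡.sym (ℕP.+-identityʳ (countPairs p))) ⟩
        2 * countPairs p ∎
        where
        S : ℕ
        S = sumFin (λ u → sumFin (λ v → ind (p u v)))

  count-minus : ∀ {n} (S X : VSet n) → count X ≤ count (λ v → not (S v) ∧ X v) + count S
  count-minus S X =
    subst₂ _≤_ (≡.sym (count-sum X))
      (trans (sumFin-+ (λ v → ind (not (S v) ∧ X v)) (λ v → ind (S v)))
             (≡.sym (cong₂ _+_ (count-sum (λ v → not (S v) ∧ X v)) (count-sum S))))
      (sumFin-mono (λ v → kept-or-deleted (S v) (X v)))
    where
    kept-or-deleted : ∀ s x → ind x ≤ ind (not s ∧ x) + ind s
    kept-or-deleted true  x     = ℕP.≤-trans (ind≤1 x) (ℕP.m≤n+m 1 0)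
    kept-or-deleted false true  = ℕP.≤-refl
    kept-or-deleted false false = z≤n

  cell : ∀ {n r} → VSet n → Part n r → Part n r → Fin r → Fin r → VSet n
  cell W Q P i l v = W v ∧ (Q v == i ∧ P v == l)

  cell⊆W : ∀ {n r} (W : VSet n) (Q P : Part n r) i l → ∀ v → cell W Q P i l v ≡ true → W v ≡ true
  cell⊆W W Q P i l v e = ∧-conicalˡ (W v) _ e

  cell⊆Q : ∀ {n r} (W : VSet n) (Q P : Part n r) i l → SubClass (cell W Q P i l) Q i
  cell⊆Q W Q P i l v e = ==⇒≡ (∧-conicalˡ (Q v == i) _ (∧-conicalʳ (W v) _ e))

  cell⊆P : ∀ {n r} (W : VSet n) (Q P : Part n r) i l → SubClass (cell W Q P i l) P l
  cell⊆P W Q P i l v e = ==⇒≡ (∧-conicalʳ (Q v == i) _ (∧-conicalʳ (W v) _ e))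

  class-decomposition : ∀ {n r} (W : VSet n) (Q P : Part n r) (i : Fin r) →
                        count (λ v → W v ∧ Q v == i) ≡ sumFin (λ l → count (cell W Q P i l))
  class-decomposition W Q P i = begin
    count (λ v → W v ∧ Q v == i)                          ≡⟨ count-sum (λ v → W v ∧ Q v == i) ⟩
    sumFin (λ v → ind (W v ∧ Q v == i))                   ≡⟨ sumFin-cong (λ v → ≡.sym (one-cell v)) ⟩
    sumFin (λ v → sumFin (λ l → ind (cell W Q P i l v)))  ≡⟨ sumFin-swap (λ v l → ind (cell W Q P i l v)) ⟩
    sumFin (λ l → sumFin (λ v → ind (cell W Q P i l v)))  ≡⟨ sumFin-cong (λ l → ≡.sym (count-sum (cell W Q P i l))) ⟩
    sumFin (λ l → count (cell W Q P i l))                 ∎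
    where
    reorder : ∀ x y z → ind (x ∧ (y ∧ z)) ≡ ind z * ind (x ∧ y)
    reorder true  true  z = ≡.sym (ℕP.*-identityʳ (ind z))
    reorder true  false z = ≡.sym (ℕP.*-zeroʳ (ind z))
    reorder false y     z = ≡.sym (ℕP.*-zeroʳ (ind z))
    -- a vertex of W ∩ Q_i lies in exactly one cell U(i,l), namely for l = P v
    one-cell : ∀ v → sumFin (λ l → ind (cell W Q P i l v)) ≡ ind (W v ∧ Q v == i)
    one-cell v = trans (sumFin-cong (λ l → reorder (W v) (Q v == i) (P v == l)))
                       (sumFin-select (P v) (λ _ → ind (W v ∧ Q v == i)))

  cell-weighted-sum : ∀ {n r} (W : VSet n) (Q P : Part n r) (w : Fin r → Fin r → ℕ) →
                      sumFin (λ v → ind (W v) * w (Q v) (P v)) ≡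
                      sumFin (λ j → sumFin (λ l → count (cell W Q P j l) * w j l))
  cell-weighted-sum {n} {r} W Q P w = begin
    sumFin (λ v → ind (W v) * w (Q v) (P v))
      ≡⟨ sumFin-cong (λ v → ≡.sym (by-cells v)) ⟩
    sumFin (λ v → sumFin (λ j → sumFin (λ l → ind (U j l v) * w j l)))
      ≡⟨ sumFin-swap (λ v j → sumFin (λ l → ind (U j l v) * w j l)) ⟩
    sumFin (λ j → sumFin (λ v → sumFin (λ l → ind (U j l v) * w j l)))
      ≡⟨ sumFin-cong (λ j → sumFin-swap (λ v l → ind (U j l v) * w j l)) ⟩
    sumFin (λ j → sumFin (λ l → sumFin (λ v → ind (U j l v) * w j l)))
      ≡⟨ sumFin-cong (λ j → sumFin-cong (λ l →
           trans (sumFin-*ʳ (w j l) (λ v → ind (U j l v))) (cong (_* w j l) (≡.sym (count-sum (U j l)))))) ⟩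
    sumFin (λ j → sumFin (λ l → count (U j l) * w j l)) ∎
    where
    U : Fin r → Fin r → VSet n
    U = cell W Q P
    reorder : ∀ x y z t → ind (x ∧ (y ∧ z)) * t ≡ ind y * (ind z * (ind x * t))
    reorder x y z t rewrite ind-∧ x (y ∧ z) | ind-∧ y z =
      solve 4 (λ a b c t → a :* (b :* c) :* t := b :* (c :* (a :* t))) refl (ind x) (ind y) (ind z) t
    -- v contributes only to its own cell U(Q v, P v)
    by-cells : ∀ v → sumFin (λ j → sumFin (λ l → ind (U j l v) * w j l)) ≡ ind (W v) * w (Q v) (P v)
    by-cells v = begin
      sumFin (λ j → sumFin (λ l → ind (U j l v) * w j l))
        ≡⟨ sumFin-cong (λ j → sumFin-cong (λ l → reorder (W v) (Q v == j) (P v == l) (w j l))) ⟩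
      sumFin (λ j → sumFin (λ l → ind (Q v == j) * (ind (P v == l) * (ind (W v) * w j l))))
        ≡⟨ sumFin-cong (λ j → sumFin-*ˡ (ind (Q v == j)) (λ l → ind (P v == l) * (ind (W v) * w j l))) ⟩
      sumFin (λ j → ind (Q v == j) * sumFin (λ l → ind (P v == l) * (ind (W v) * w j l)))
        ≡⟨ sumFin-cong (λ j → cong (ind (Q v == j) *_) (sumFin-select (P v) (λ l → ind (W v) * w j l))) ⟩
      sumFin (λ j → ind (Q v == j) * (ind (W v) * w j (P v)))
        ≡⟨ sumFin-select (Q v) (λ j → ind (W v) * w j (P v)) ⟩
      ind (W v) * w (Q v) (P v) ∎

  misplaced-decomposition : ∀ {n r} (W : VSet n) (Q P : Part n r) (f : Fin r → Fin r) →
    count (λ v → W v ∧ not (P v == f (Q v))) ≡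
    sumFin (λ j → sumFin (λ l → count (cell W Q P j l) * ind (not (l == f j))))
  misplaced-decomposition W Q P f =
    trans (count-sum (λ v → W v ∧ not (P v == f (Q v))))
          (trans (sumFin-cong (λ v → ind-∧ (W v) (not (P v == f (Q v)))))
                 (cell-weighted-sum W Q P (λ j l → ind (not (l == f j)))))

-- The constants of steps (3) and (4).  With k = r + 1,
--   c₁ r = k³ - r (k + 1) = r³ + 2r² + r + 1   and   c₂ r = k³ r².
module Constants where

  open import Data.Nat as ℕ using (ℕ; zero; suc; _+_; _*_; _^_; _≤_; z≤n)
  import Data.Nat.Properties as ℕP
  open import Data.Nat.Solver using (module +-*-Solver)
  open +-*-Solver
  open import Relation.Binary.PropositionalEquality hiding (sym)
  import Relation.Binary.PropositionalEquality as ≡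

  c₁ : ℕ → ℕ
  c₁ r = r * r * r + 2 * (r * r) + r + 1

  c₁-positive : ∀ r → 1 ≤ c₁ r
  c₁-positive r = ℕP.m≤n+m 1 (r * r * r + 2 * (r * r) + r)

  c₂ : ℕ → ℕ
  c₂ r = suc r ^ 3 * (r * r)

  -- Let k = r + 1.  If k³ n ≤ k³ (r q) + r n (the class
  -- size q is close to n/r), q ≤ q' + s (deleting s vertices leaves q'),
  -- q' ≤ r a (a is the largest of r parts of q') and k² s ≤ n, then c₁ n ≤ c₂ a.
  largest-part-bound : ∀ r n q q' s a →
    suc r ^ 3 * n ≤ suc r ^ 3 * (r * q) + n * r → q ≤ q' + s → q' ≤ r * a →
    suc r * suc r * s ≤ n → n * c₁ r ≤ c₂ r * a
  largest-part-bound r n q q' s a close q≤q'+s q'≤ra k²s≤n = ℕP.+-cancelʳ-≤ X (n * c₁ r) (c₂ r * a) (begin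
      n * c₁ r + X                       ≡⟨ solve 2 (λ r n → n :* (r :* r :* r :+ con 2 :* (r :* r) :+ r :+ con 1)
                                              :+ ((con 1 :+ r) :* r :* n :+ n :* r) := (con 1 :+ r) :^ 3 :* n) refl r n ⟩
      k ^ 3 * n                          ≤⟨ close ⟩
      k ^ 3 * (r * q) + n * r            ≤⟨ ℕP.+-monoˡ-≤ (n * r) k³rq≤ ⟩
      c₂ r * a + k * r * n + n * r       ≡⟨ ℕP.+-assoc (c₂ r * a) (k * r * n) (n * r) ⟩
      c₂ r * a + X                       ∎)
    where
    open ℕP.≤-Reasoning
    k X : ℕ
    k = suc r
    X = k * r * n + n * r
    k³rq≤ : k ^ 3 * (r * q) ≤ c₂ r * a + k * r * n
    k³rq≤ = begin
      k ^ 3 * (r * q)                    ≤⟨ ℕP.*-monoʳ-≤ (k ^ 3) (ℕP.*-monoʳ-≤ r (ℕP.≤-trans q≤q'+s (ℕP.+-monoˡ-≤ s q'≤ra))) ⟩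
      k ^ 3 * (r * (r * a + s))          ≡⟨ solve 3 (λ r a s → ((con 1 :+ r) :^ 3) :* (r :* (r :* a :+ s))
                                              := ((con 1 :+ r) :^ 3 :* (r :* r)) :* a
                                                 :+ (con 1 :+ r) :* r :* ((con 1 :+ r) :* (con 1 :+ r) :* s)) refl r a s ⟩
      c₂ r * a + k * r * (k * k * s)     ≤⟨ ℕP.+-monoʳ-≤ (c₂ r * a) (ℕP.*-monoʳ-≤ (k * r) k²s≤n) ⟩
      c₂ r * a + k * r * n               ∎

  -- Since r² ≤ c₁ r, the bound c₁ n ≤ c₂ a implies n ≤ k³ a.
  n≤k³a : ∀ r n a → n * c₁ r ≤ c₂ r * a → n ≤ suc r ^ 3 * a
  n≤k³a zero n a c₁n≤c₂a =
    ℕP.≤-trans (subst (_≤ 0) (ℕP.*-identityʳ n) (ℕP.≤-trans c₁n≤c₂a (ℕP.≤-reflexive (ℕP.*-zeroˡ a)))) z≤n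
  n≤k³a r@(suc _) n a c₁n≤c₂a = ℕP.*-cancelʳ-≤ n (suc r ^ 3 * a) (r * r) (ℕP.≤-trans (ℕP.*-monoʳ-≤ n r²≤c₁)
      (ℕP.≤-trans c₁n≤c₂a (ℕP.≤-reflexive
        (solve 2 (λ r a → ((con 1 :+ r) :^ 3 :* (r :* r)) :* a := ((con 1 :+ r) :^ 3 :* a) :* (r :* r)) refl r a))))
    where
    r²≤c₁ : r * r ≤ c₁ r
    r²≤c₁ = subst (r * r ≤_)
      (solve 1 (λ r → r :* r :+ (r :* r :* r :+ r :* r :+ r :+ con 1) := r :* r :* r :+ con 2 :* (r :* r) :+ r :+ con 1) refl r)
      (ℕP.m≤m+n (r * r) (r * r * r + r * r + r + 1))

  -- The final count: r² · c₂ n² ≤ k⁴ n · c₁ n, since r⁴ ≤ k c₁.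
  final-constant : ∀ r n → r * (r * (c₂ r * (n * n))) ≤ (suc r ^ 4 * n) * (n * c₁ r)
  final-constant r n = subst₂ _≤_
      (solve 2 (λ r n → (r :* r :* r :* r) :* ((con 1 :+ r) :^ 3 :* (n :* n))
                := r :* (r :* (((con 1 :+ r) :^ 3 :* (r :* r)) :* (n :* n)))) refl r n)
      (solve 2 (λ r n → ((con 1 :+ r) :* (r :* r :* r :+ con 2 :* (r :* r) :+ r :+ con 1)) :* ((con 1 :+ r) :^ 3 :* (n :* n))
                := ((con 1 :+ r) :^ 4 :* n) :* (n :* (r :* r :* r :+ con 2 :* (r :* r) :+ r :+ con 1))) refl r n)
      (ℕP.*-monoˡ-≤ (suc r ^ 3 * (n * n)) r⁴≤kc₁)
    where
    r⁴≤kc₁ : r * r * r * r ≤ suc r * c₁ r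
    r⁴≤kc₁ = subst (r * r * r * r ≤_)
      (solve 1 (λ r → r :* r :* r :* r :+ (con 3 :* (r :* r :* r) :+ con 3 :* (r :* r) :+ con 2 :* r :+ con 1)
                 := (con 1 :+ r) :* (r :* r :* r :+ con 2 :* (r :* r) :+ r :+ con 1)) refl r)
      (ℕP.m≤m+n _ _)

module Stability
  (r₀ n : ℕ) (n≥1 : 1 ≤ n) (ν μ m : ℚ)
  (ν>0 : 0ℚ <ℚ ν) (νk³≤1 : ν *ℚ toℚ (suc (suc r₀) ^ 3) ≤ℚ 1ℚ)
  (μ>0 : 0ℚ <ℚ μ) (μk³≤1 : μ *ℚ toℚ (suc (suc r₀) ^ 3) ≤ℚ 1ℚ)
  (4m<ν²n² : toℚ 4 *ℚ m <ℚ (ν *ℚ ν) *ℚ toℚ (n * n))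
  (Q : Part n (suc r₀)) (S : VSet n) (S-small : (suc (suc r₀) * suc (suc r₀)) * count S ≤ n)
  (G : Graph n) (F2μ : F2 μ Q) (F1ν : F1 ν G Q) (hQ≤m : toℚ (h full G Q) ≤ℚ m)
  (P : Part n (suc r₀)) (P-optimal : Optimal (minus S) G P)
  where

  open import Data.Bool using (_∧_; not)
  import Data.Nat.Properties as ℕP
  open import Data.Fin.Properties using (_≟_)
  open import Data.Rational as ℚ using ()
  import Data.Rational.Properties as ℚP
  open import Data.Product using (proj₁)
  open import Data.Empty using (⊥-elim)
  open import Relation.Nullary using (yes; no; ¬_)
  open import Function.Bundles using (_↔_; mk↔ₛ′)
  open import Relation.Binary.PropositionalEquality hiding (sym)
  import Relation.Binary.PropositionalEquality as ≡
  open NatEmbedding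
  open Counting
  open Cells
  open Constants

  r k : ℕ
  r = suc r₀
  k = suc r

  W : VSet n
  W = minus S

  ν² : ℚ
  ν² = ν ℚ.* ν

  threshold : ℚ
  threshold = ν² ℚ.* toℚ (n * n)

  0≤ν² : 0ℚ ℚ.≤ ν²
  0≤ν² = *-nonNeg (ℚP.<⇒≤ ν>0) (ℚP.<⇒≤ ν>0)

  a : Fin r → Fin r → ℕ
  a i l = count (cell W Q P i l)

  h-P-small : toℚ (4 * h W G P) ℚ.< threshold
  h-P-small = four-times-below threshold m (h W G P) (h full G Q)
                (ℕP.≤-trans (P-optimal Q) (h-deletion W G Q)) hQ≤m 4m<ν²n²

  small-products : ∀ i j l → i ≢ j → ¬ (threshold ℚ.≤ toℚ (a i l * a j l))
  small-products i j l i≢j large =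
    ℚP.<-irrefl refl (ℚP.<-≤-trans h-P-small (ℚP.≤-trans large (toℚ-mono ab≤4h)))
    where
    Ui Uj : VSet n
    Ui = cell W Q P i l
    Uj = cell W Q P j l
    dense : 4 * eCount G Ui Uj ≤ 3 * (a i l * a j l)
    dense = proj₂ (F1ν i j i≢j Ui Uj (cell⊆Q W Q P i l) (cell⊆Q W Q P j l) large)
    nonEdges≤h : nonEdges G Ui Uj ≤ h W G P
    nonEdges≤h = cross-nonEdges≤h G W Ui Uj P (cell⊆W W Q P i l) (cell⊆W W Q P j l)
      (λ v in-i in-j → i≢j (trans (≡.sym (cell⊆Q W Q P i l v in-i)) (cell⊆Q W Q P j l v in-j)))
      (λ u v in-i in-j → trans (cell⊆P W Q P i l u in-i) (≡.sym (cell⊆P W Q P j l v in-j)))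
    ab≤4h : a i l * a j l ≤ 4 * h W G P
    ab≤4h = ℕP.≤-trans (quarter-nonEdges G Ui Uj dense) (ℕP.*-monoʳ-≤ 4 nonEdges≤h)

  f : Fin r → Fin r
  f i = proj₁ (argmax (a i))

  largest-cell : ∀ i → n * c₁ r ≤ c₂ r * a i (f i)
  largest-cell i = largest-part-bound r n (count (λ v → Q v == i)) (count (λ v → W v ∧ Q v == i))
    (count S) (a i (f i))
    (approx-lower μ (k ^ 3) (r * count (λ v → Q v == i)) n (n * r) (ℚP.<⇒≤ μ>0) μk³≤1 (F2μ i))
    (count-minus S (λ v → Q v == i))
    (subst (_≤ r * a i (f i)) (≡.sym (class-decomposition W Q P i))
      (sumFin-≤ (a i (f i)) (a i) (proj₂ (argmax (a i)))))
    S-small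

  -- Two largest cells are both above size n/k³, so by (2) they lie in
  -- different classes of P.
  f-injective : ∀ {i j} → f i ≡ f j → i ≡ j
  f-injective {i} {j} fi≡fj with i ≟ j
  ... | yes i≡j = i≡j
  ... | no i≢j = ⊥-elim (small-products i j (f i) i≢j
        (product-above-threshold ν (k ^ 3) n (a i (f i)) (a j (f i)) (ℚP.<⇒≤ ν>0) νk³≤1
          (n≤k³a r n _ (largest-cell i))
          (subst (λ l → n ≤ k ^ 3 * a j l) (≡.sym fi≡fj) (n≤k³a r n _ (largest-cell j)))))

  f-surjective : ∀ l → Σ (Fin r) λ i → f i ≡ l
  f-surjective = injective⇒surjective f f-injective

  σ : Fin r ↔ Fin r
  σ = mk↔ₛ′ f (λ l → proj₁ (f-surjective l)) (λ l → proj₂ (f-surjective l))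
             (λ i → f-injective (proj₂ (f-surjective (f i))))

  moved : ℕ
  moved = count (λ v → W v ∧ not (P v == f (Q v)))

  L : ℕ
  L = n * c₁ r

  off-cell : Fin r → Fin r → ℕ
  off-cell j l = a j l * ind (not (l == f j)) * L

  -- A cell U(j,l) off the permutation has a(j,l) c₁ n ≤ ν² c₂ n²: l = f i for
  -- some i ≠ j, and a(j,l) a(i,l) < ν² n² by (2) while c₁ n ≤ c₂ a(i,l) by (3).
  -- (Splitting on l ≟ f j also decides the test l == f j inside off-cell.)
  off-cell-bound : ∀ j l → toℚ (off-cell j l) ℚ.≤ ν² ℚ.* toℚ (c₂ r * (n * n))
  off-cell-bound j l with l ≟ f j
  ... | yes _ rewrite ℕP.*-zeroʳ (a j l) =
        *-nonNeg 0≤ν² (toℚ-nonNeg (c₂ r * (n * n)))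
  ... | no l≢fj rewrite ℕP.*-identityʳ (a j l) =
        below-threshold ν² (n * n) (c₂ r) (a j l * a i l) (a j l * L) 0≤ν²
          (small-products j i l j≢i) (ℕP.≤-trans (ℕP.*-monoʳ-≤ (a j l) L≤c₂a) reorder)
    where
    i : Fin r
    i = proj₁ (f-surjective l)
    fi≡l : f i ≡ l
    fi≡l = proj₂ (f-surjective l)
    j≢i : j ≢ i
    j≢i j≡i = l≢fj (trans (≡.sym fi≡l) (cong f (≡.sym j≡i)))
    L≤c₂a : L ≤ c₂ r * a i l
    L≤c₂a = subst (λ l' → L ≤ c₂ r * a i l') fi≡l (largest-cell i)
    reorder : a j l * (c₂ r * a i l) ≤ c₂ r * (a j l * a i l)
    reorder = ℕP.≤-reflexive (trans (≡.sym (ℕP.*-assoc (a j l) (c₂ r) (a i l)))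
               (trans (cong (_* a i l) (ℕP.*-comm (a j l) (c₂ r))) (ℕP.*-assoc (c₂ r) (a j l) (a i l))))

  moved-as-sum : sumFin (λ j → sumFin (off-cell j)) ≡ moved * L
  moved-as-sum = begin
    sumFin (λ j → sumFin (off-cell j))
      ≡⟨ sumFin-cong (λ j → sumFin-*ʳ L (λ l → a j l * ind (not (l == f j)))) ⟩
    sumFin (λ j → sumFin (λ l → a j l * ind (not (l == f j))) * L)
      ≡⟨ sumFin-*ʳ L (λ j → sumFin (λ l → a j l * ind (not (l == f j)))) ⟩
    sumFin (λ j → sumFin (λ l → a j l * ind (not (l == f j)))) * L
      ≡⟨ cong (_* L) (≡.sym (misplaced-decomposition W Q P f)) ⟩
    moved * L ∎
    where open ≡-Reasoning

  -- Summing (4) over the r² cells and cancelling L = c₁ n.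
  stable : InNbhd W Q P (toℚ (k ^ 4) ℚ.* ν² ℚ.* toℚ n)
  stable = σ , cancel-positive ν² moved L (r * (r * (c₂ r * (n * n)))) (k ^ 4) n 0≤ν²
    (subst (λ x → toℚ x ℚ.≤ ν² ℚ.* toℚ (r * (r * (c₂ r * (n * n))))) moved-as-sum
      (sumFin-≤-scaled ν² (r * (c₂ r * (n * n))) (λ j → sumFin (off-cell j)) λ j →
        sumFin-≤-scaled ν² (c₂ r * (n * n)) (off-cell j) (off-cell-bound j)))
    (final-constant r n)
    (ℕP.*-mono-≤ n≥1 (c₁-positive r))

-- Lemma 5.5, with n₀ = 1: for k = r + 1 ≥ 2 apply Stability to the data of
-- each n ≥ 1 (only (F2)_μ is taken from G ∈ F_Q(n,k,η,μ)).
lemma5p5 :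
    (k : ℕ) → 4 ≤ k →
    (η μ : ℚ) → 0ℚ <ℚ η → η *ℚ toℚ (k ^ 3) ≤ℚ 1ℚ →
    0ℚ <ℚ μ → μ *ℚ toℚ (k ^ 3) ≤ℚ 1ℚ →
    (ν : ℕ → ℚ) → (∀ n → 0ℚ <ℚ ν n) → (∀ n → ν n *ℚ toℚ (k ^ 3) ≤ℚ 1ℚ) →
    (m : ℕ → ℚ) → (∀ n → 0ℚ ≤ℚ m n) → (∀ n → m n ≤ℚ toℚ (n * n)) →
    (∀ n → 1 ≤ n → toℚ 4 *ℚ m n <ℚ (ν n *ℚ ν n) *ℚ toℚ (n * n)) →
    Σ ℕ λ n₀ → ∀ n → n₀ ≤ n →
      ∀ (Q : Part n (k ∸ 1)) (S : VSet n) → (k * k) * count S ≤ n →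
      ∀ (G : Graph n) → FQμ k η μ Q G → F1 (ν n) G Q →
        toℚ (h full G Q) ≤ℚ m n →
        ∀ (P : Part n (k ∸ 1)) → Optimal (minus S) G P →
          InNbhd (minus S) Q P (toℚ (k ^ 4) *ℚ (ν n *ℚ ν n) *ℚ toℚ n)
lemma5p5 (suc (suc r₀)) (s≤s (s≤s _)) η μ _ _ μ>0 μk³≤1 ν ν>0 νk³≤1 m _ _ 4m<ν²n² =
  1 , λ n n≥1 Q S S-small G G∈FQμ F1ν hQ≤m P P-optimal →
    Stability.stable r₀ n n≥1 (ν n) μ (m n) (ν>0 n) (νk³≤1 n) μ>0 μk³≤1 (4m<ν²n² n n≥1)
      Q S S-small G (proj₂ (proj₂ G∈FQμ)) F1ν hQ≤m P P-optimal
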